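{- Let $K$ be a finite field of characteristic $p$ and order $q$, $s$ a positive integer with $\gcd(s,q-1)=1$, and $w\in K$. (i) $Q^{(1,-1)}_{1,w}=Q^{(1,-1)}_{1,-w}$. (ii) If $p$ is odd, then $Q^{(1,-1)}_{1,1}-1=Q^{(1,-1)}_{1,-1}-1=Q^{(1,1)}_{1,-1}$. (iii) If $p$ is odd and $w=2^{1/s-1}$, then $Q^{(1,1)}_{1,w}$ is odd; otherwise $Q^{(1,1)}_{1,w}$ is even.
   Context: For $t=(t_1,t_2)\in(K^\times)^2$ and $a,b\in K$, $Q^t_{a,b}$ denotes the number of $(v_1,v_2)\in K^2$ with $t_1v_1+t_2v_2=a$ and $v_1^s+v_2^s=b^s$. Here $1/s$ denotes the inverse of $s$ modulo $q-1$, so $x\mapsto x^{1/s}$ is the inverse of the permutation $x\mapsto x^s$ of $K$, and $2^{1/s-1}=2^{1/s}/2$. -}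

module Defs where

open import Level using (0ℓ)
open import Data.Nat as ℕ using (ℕ; zero; suc)
open import Data.Product using (_×_; _,_)
open import Data.List using (List; []; _∷_; length; filter; cartesianProduct)
open import Data.List.Membership.Propositional using (_∈_)
open import Data.List.Relation.Unary.Unique.Propositional using (Unique)
open import Relation.Nullary using (¬_; Dec; yes; no)
open import Relation.Nullary.Decidable using (_×-dec_)
open import Relation.Binary.PropositionalEquality using (_≡_)
open import Algebra.Structures using (IsCommutativeRing)

record FiniteField : Set₁ where
  infixl 6 _+_
  infixl 7 _*_
  field
    Carrier : Set
    _+_ _*_ : Carrier → Carrier → Carrier
    -_      : Carrier → Carrier
    0# 1#   : Carrier
    isCommutativeRing : IsCommutativeRing _≡_ _+_ _*_ -_ 0# 1#
    _⁻¹     : Carrier → Carrier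
    inverseʳ : ∀ x → ¬ (x ≡ 0#) → x * (x ⁻¹) ≡ 1#
    0≢1     : ¬ (0# ≡ 1#)
    _≟_     : (x y : Carrier) → Dec (x ≡ y)
    elements : List Carrier
    elements-unique   : Unique elements
    elements-complete : ∀ x → x ∈ elements

  order : ℕ
  order = length elements

  _^_ : Carrier → ℕ → Carrier
  x ^ zero  = 1#
  x ^ suc n = x * (x ^ n)

  fromℕ : ℕ → Carrier
  fromℕ zero    = 0#
  fromℕ (suc n) = 1# + fromℕ n

  -- the field has characteristic p (p prime is imposed separately)
  HasChar : ℕ → Set
  HasChar p = fromℕ p ≡ 0#

  -- x ↦ x^{1/s}: inverse of the map x ↦ x^s (a permutation when
  -- gcd(s,q-1)=1), computed by searching the element list for the
  -- (then unique) preimage; the default 0# is never used in that case.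
  rootOf : ℕ → Carrier → Carrier
  rootOf s y = go elements
    where
    go : List Carrier → Carrier
    go [] = 0#
    go (x ∷ xs) with (x ^ s) ≟ y
    ... | yes _ = x
    ... | no  _ = go xs

  -- Q^t_{a,b} for t = (t₁,t₂): number of (v₁,v₂) ∈ K² with
  -- t₁v₁ + t₂v₂ = a and v₁^s + v₂^s = b^s.
  Q : ℕ → Carrier → Carrier → Carrier → Carrier → ℕ
  Q s t₁ t₂ a b =
    length (filter (λ v → let (v₁ , v₂) = v in
                      ((t₁ * v₁ + t₂ * v₂) ≟ a) ×-dec (((v₁ ^ s) + (v₂ ^ s)) ≟ (b ^ s)))
                   (cartesianProduct elements elements))

{-# OPTIONS --safe #-}
module Submission where

-- (i) (v₁ , v₂) ↦ (- v₂ , - v₁) matches the solutions for w with those for - w, because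
-- (- x) ^ s ≡ - x ^ s: in characteristic 2, - x ≡ x, and otherwise q - 1 is even (negation
-- pairs off the units), so s is odd.
-- (ii) The first equation is (i) at w = 1. For the second, (0 , - 1) is the only solution of
-- v₁ - v₂ = 1 with v₁ ≡ 0, and (v₁ , v₂) ↦ (v₂ / v₁ , 1 / v₁) maps the others bijectively onto
-- the solutions of u₁ + u₂ = 1, v₁ ^ s + v₂ ^ s = - 1.
-- (iii) Swapping coordinates pairs off the solutions of u₁ + u₂ = 1 off the diagonal, so the
-- parity is that of the number of diagonal solutions. A diagonal solution has u₁ = u₂ = 1/2
-- (impossible in characteristic 2), and as x ↦ x ^ s is injective (Bézout and Fermat), (1/2 , 1/2)
-- is a solution exactly when w = 2^{1/s} / 2.

open import Defs
open import Level using (0ℓ)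
open import Algebra.Bundles using (CommutativeRing)
open import Data.Empty using (⊥-elim)
open import Data.List using (List; []; _∷_; length; filter; map; foldr; cartesianProduct)
open import Data.List.Properties using (length-map)
open import Data.List.Membership.Propositional using (_∈_; _∉_)
open import Data.List.Membership.Propositional.Properties
  using (∈-filter⁺; ∈-filter⁻; ∈-map⁺; ∈-map⁻; ∈-cartesianProduct⁺)
open import Data.List.Membership.Propositional.Properties.WithK using (unique∧set⇒bag)
open import Data.List.Relation.Binary.BagAndSetEquality using (∼bag⇒↭)
open import Data.List.Relation.Binary.Permutation.Propositional using (_↭_; ↭⇒↭ₛ)
open import Data.List.Relation.Binary.Permutation.Propositional.Properties using (↭-length)
open import Data.List.Relation.Binary.Permutation.Setoid.Properties using (foldr-commMonoid)
open import Data.List.Relation.Unary.All as All using ([])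
import Data.List.Relation.Unary.All.Properties as All
open import Data.List.Relation.Unary.AllPairs using ([]; _∷_)
open import Data.List.Relation.Unary.Any using (here; there)
open import Data.List.Relation.Unary.Unique.Propositional using (Unique)
import Data.List.Relation.Unary.Unique.Propositional.Properties as Unique
import Data.Nat as ℕ
open import Data.Nat using (ℕ; zero; suc; _≤_; s≤s; _∸_; _%_; _>_)
import Data.Nat.Properties as ℕ
open import Data.Nat.Coprimality using (Coprime; gcd≡1⇒coprime; coprime-Bézout)
open import Data.Nat.DivMod using (_/_; m≡m%n+[m/n]*n; m%n<n; %-remove-+ʳ)
open import Data.Nat.Divisibility using (_∣_; divides; ∣-refl; ∣m∣n⇒∣m+n; m%n≡0⇒n∣m)
open import Data.Nat.GCD using (gcd; module Bézout)
open import Data.Nat.Primality using (Prime; prime⇒irreducible)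
open import Data.Product using (_×_; _,_; proj₁; proj₂; ∃; swap)
open import Data.Product.Properties using (≡-dec)
open import Data.Sum using (_⊎_; inj₁; inj₂; fromInj₁)
open import Function.Base using (case_of_)
open import Function.Bundles using (mk⇔)
open import Relation.Binary.Definitions using (DecidableEquality)
open import Relation.Binary.PropositionalEquality
  using (_≡_; _≢_; refl; sym; trans; cong; cong₂; subst; setoid; module ≡-Reasoning)
open import Relation.Nullary using (¬_; yes; no; ¬?)
open import Relation.Nullary.Decidable using (_×-dec_)
open import Relation.Unary using (Pred; Decidable)
open import Relation.Unary.Properties using (∁?)

-- Counting in duplicate-free lists

module _ {A : Set} where

  unique-same-members⇒↭ : {xs ys : List A} → Unique xs → Unique ys →
    (∀ {x} → x ∈ xs → x ∈ ys) → (∀ {x} → x ∈ ys → x ∈ xs) → xs ↭ ys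
  unique-same-members⇒↭ u v ⊆ ⊇ = ∼bag⇒↭ (unique∧set⇒bag u v (mk⇔ ⊆ ⊇))

  length-filter-∁ : {P : Pred A 0ℓ} (P? : Decidable P) (xs : List A) →
    length xs ≡ length (filter P? xs) ℕ.+ length (filter (∁? P?) xs)
  length-filter-∁ P? [] = refl
  length-filter-∁ P? (x ∷ xs) with P? x
  ... | yes _ = cong suc (length-filter-∁ P? xs)
  ... | no  _ = trans (cong suc (length-filter-∁ P? xs)) (sym (ℕ.+-suc _ _))

  length≡0 : {xs : List A} → (∀ {x} → x ∉ xs) → length xs ≡ 0
  length≡0 {[]}    _    = refl
  length≡0 {x ∷ _} x∉xs = ⊥-elim (x∉xs (here refl))

  length≡1 : {xs : List A} {e : A} → Unique xs → e ∈ xs → (∀ {x} → x ∈ xs → x ≡ e) →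
    length xs ≡ 1
  length≡1 u e∈xs only-e = ↭-length (unique-same-members⇒↭ u ([] ∷ [])
    (λ x∈xs → here (only-e x∈xs)) (λ { (here refl) → e∈xs }))

  module _ (_≟_ : DecidableEquality A) where

    length-filter-≢ : {xs : List A} {x : A} → Unique xs → x ∈ xs →
      length xs ≡ suc (length (filter (λ y → ¬? (y ≟ x)) xs))
    length-filter-≢ {xs} {x} u x∈xs =
      trans (length-filter-∁ (_≟ x) xs) (cong (ℕ._+ length (filter (∁? (_≟ x)) xs)) x-once)
      where
      x-once : length (filter (_≟ x) xs) ≡ 1
      x-once = length≡1 (Unique.filter⁺ (_≟ x) u) (∈-filter⁺ (_≟ x) x∈xs refl)
        (λ y∈ → proj₂ (∈-filter⁻ (_≟ x) {xs = xs} y∈))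

    2∣length-involution : (σ : A → A) → (∀ x → σ (σ x) ≡ x) →
      {xs : List A} → Unique xs → (∀ {x} → x ∈ xs → σ x ∈ xs) →
      (∀ {x} → x ∈ xs → σ x ≢ x) → 2 ∣ length xs
    2∣length-involution σ σσ {xs} = go (length xs) ℕ.≤-refl
      where
      -- Recursion on a bound n for the length, as each step removes both x and σ x.
      go : ∀ n {xs} → length xs ≤ n → Unique xs → (∀ {x} → x ∈ xs → σ x ∈ xs) →
        (∀ {x} → x ∈ xs → σ x ≢ x) → 2 ∣ length xs
      go _       {[]}     _         _        _       _     = divides 0 refl
      go (suc n) {x ∷ ys} (s≤s len) (x∉ ∷ u) closed no-fix =
        subst (2 ∣_) (cong suc (sym ys≡)) (∣m∣n⇒∣m+n ∣-refl (go n len′ zs-unique zs-closed zs-no-fix))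
        where
        σx∈ys : σ x ∈ ys
        σx∈ys with closed (here refl)
        ... | here σx≡x = ⊥-elim (no-fix (here refl) σx≡x)
        ... | there σx∈ = σx∈
        zs : List A
        zs = filter (λ y → ¬? (y ≟ σ x)) ys
        ys≡ : length ys ≡ suc (length zs)
        ys≡ = length-filter-≢ u σx∈ys
        len′ : length zs ≤ n
        len′ = ℕ.≤-trans (ℕ.n≤1+n _) (subst (_≤ n) ys≡ len)
        zs-unique : Unique zs
        zs-unique = Unique.filter⁺ _ u
        zs-closed : ∀ {z} → z ∈ zs → σ z ∈ zs
        zs-closed {z} z∈zs with ∈-filter⁻ (λ y → ¬? (y ≟ σ x)) {xs = ys} z∈zs
        ... | z∈ys , z≢σx = ∈-filter⁺ (λ y → ¬? (y ≟ σ x)) σz∈ys σz≢σx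
          where
          σz≢σx : σ z ≢ σ x
          σz≢σx σz≡σx = All.lookup x∉ z∈ys (trans (sym (σσ x)) (trans (cong σ (sym σz≡σx)) (σσ z)))
          σz∈ys : σ z ∈ ys
          σz∈ys with closed (there z∈ys)
          ... | here σz≡x = ⊥-elim (z≢σx (trans (sym (σσ z)) (cong σ σz≡x)))
          ... | there σz∈ = σz∈
        zs-no-fix : ∀ {z} → z ∈ zs → σ z ≢ z
        zs-no-fix z∈zs = no-fix (there (proj₁ (∈-filter⁻ (λ y → ¬? (y ≟ σ x)) {xs = ys} z∈zs)))

module _ {A B : Set} where

  unique-map⁺ : (f : A → B) {xs : List A} → Unique xs →
    (∀ {x y} → x ∈ xs → y ∈ xs → f x ≡ f y → x ≡ y) → Unique (map f xs)
  unique-map⁺ f []           _   = []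
  unique-map⁺ f (x∉xs ∷ u) inj =
    All.map⁺ (All.tabulate λ y∈xs fx≡fy → All.lookup x∉xs y∈xs (inj (here refl) (there y∈xs) fx≡fy))
    ∷ unique-map⁺ f u (λ x∈ y∈ → inj (there x∈) (there y∈))

  length-≡-inverses : {xs : List A} {ys : List B} (f : A → B) (g : B → A) →
    Unique xs → Unique ys →
    (∀ {x} → x ∈ xs → f x ∈ ys) → (∀ {y} → y ∈ ys → g y ∈ xs) →
    (∀ {x} → x ∈ xs → g (f x) ≡ x) → (∀ {y} → y ∈ ys → f (g y) ≡ y) →
    length xs ≡ length ys
  length-≡-inverses {xs} {ys} f g u v f∈ g∈ gf fg = trans (sym (length-map f xs))
    (↭-length (unique-same-members⇒↭ (unique-map⁺ f u f-injective) v ⊆ ⊇))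
    where
    f-injective : ∀ {x y} → x ∈ xs → y ∈ xs → f x ≡ f y → x ≡ y
    f-injective x∈ y∈ fx≡fy = trans (sym (gf x∈)) (trans (cong g fx≡fy) (gf y∈))
    ⊆ : ∀ {y} → y ∈ map f xs → y ∈ ys
    ⊆ y∈ with ∈-map⁻ f y∈
    ... | x , x∈xs , refl = f∈ x∈xs
    ⊇ : ∀ {y} → y ∈ ys → y ∈ map f xs
    ⊇ y∈ys = subst (_∈ map f xs) (fg y∈ys) (∈-map⁺ f (g∈ y∈ys))

n%2≡0⊎n%2≡1 : ∀ n → n % 2 ≡ 0 ⊎ n % 2 ≡ 1
n%2≡0⊎n%2≡1 n with n % 2 | m%n<n n 2
... | 0           | _               = inj₁ refl
... | 1           | _               = inj₂ refl
... | suc (suc _) | s≤s (s≤s ())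

odd⇒≡1+[n/2]*2 : ∀ n → n % 2 ≡ 1 → n ≡ suc (n / 2 ℕ.* 2)
odd⇒≡1+[n/2]*2 n odd = trans (m≡m%n+[m/n]*n n 2) (cong (ℕ._+ n / 2 ℕ.* 2) odd)

-- Finite fields

module FiniteFieldProperties (K : FiniteField) where

  open FiniteField K

  commutativeRing : CommutativeRing 0ℓ 0ℓ
  commutativeRing = record { isCommutativeRing = isCommutativeRing }

  open CommutativeRing commutativeRing
    using (_-_; +-assoc; +-comm; +-identityˡ; +-identityʳ; -‿inverseˡ; -‿inverseʳ;
           *-assoc; *-comm; *-identityˡ; *-identityʳ; distribˡ; zeroˡ; zeroʳ;
           ring; semiring; commutativeSemiring; +-abelianGroup; *-isCommutativeMonoid)
  open import Algebra.Properties.Ring ring using (-1*x≈-x; -‿distribʳ-*)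
  open import Algebra.Properties.AbelianGroup +-abelianGroup
    using (⁻¹-∙-comm; inverseʳ-unique; ε⁻¹≈ε; xyx⁻¹≈y) renaming (⁻¹-involutive to -‿involutive)
  open import Algebra.Properties.Semiring.Mult semiring using (×1-homo-*) renaming (_×_ to _×ᴿ_)
  import Algebra.Properties.Semiring.Exp semiring as Exp
  import Algebra.Properties.CommutativeSemiring.Exp commutativeSemiring as CExp
  open ≡-Reasoning

  two : Carrier
  two = 1# + 1#

  x+x≡x*two : ∀ x → x + x ≡ x * two
  x+x≡x*two x = sym (trans (distribˡ x 1# 1#) (cong₂ _+_ (*-identityʳ x) (*-identityʳ x)))

  1*x+1*y≡x+y : ∀ x y → 1# * x + 1# * y ≡ x + y
  1*x+1*y≡x+y x y = cong₂ _+_ (*-identityˡ x) (*-identityˡ y)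

  1*x+-1*y≡x-y : ∀ x y → 1# * x + (- 1#) * y ≡ x - y
  1*x+-1*y≡x-y x y = cong₂ _+_ (*-identityˡ x) (-1*x≈-x y)

  x+y≡-1⇒y+1≡-x : ∀ x y → x + y ≡ - 1# → y + 1# ≡ - x
  x+y≡-1⇒y+1≡-x x y x+y≡-1 = inverseʳ-unique x (y + 1#) (begin
    x + (y + 1#)   ≡⟨ sym (+-assoc x y 1#) ⟩
    (x + y) + 1#   ≡⟨ cong (_+ 1#) x+y≡-1 ⟩
    (- 1#) + 1#    ≡⟨ -‿inverseˡ 1# ⟩
    0#             ∎)

  x⁻¹*x≡1 : ∀ {x} → x ≢ 0# → x ⁻¹ * x ≡ 1#
  x⁻¹*x≡1 {x} x≢0 = trans (*-comm (x ⁻¹) x) (inverseʳ x x≢0)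

  *-cancelˡ : ∀ {a x y} → a ≢ 0# → a * x ≡ a * y → x ≡ y
  *-cancelˡ {a} {x} {y} a≢0 ax≡ay = begin
    x                ≡⟨ sym (*-identityˡ x) ⟩
    1# * x           ≡⟨ cong (_* x) (sym (x⁻¹*x≡1 a≢0)) ⟩
    (a ⁻¹ * a) * x   ≡⟨ *-assoc (a ⁻¹) a x ⟩
    a ⁻¹ * (a * x)   ≡⟨ cong (a ⁻¹ *_) ax≡ay ⟩
    a ⁻¹ * (a * y)   ≡⟨ sym (*-assoc (a ⁻¹) a y) ⟩
    (a ⁻¹ * a) * y   ≡⟨ cong (_* y) (x⁻¹*x≡1 a≢0) ⟩
    1# * y           ≡⟨ *-identityˡ y ⟩
    y                ∎

  x*y≡0⇒x≡0⊎y≡0 : ∀ x y → x * y ≡ 0# → x ≡ 0# ⊎ y ≡ 0#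
  x*y≡0⇒x≡0⊎y≡0 x y xy≡0 with x ≟ 0#
  ... | yes x≡0 = inj₁ x≡0
  ... | no  x≢0 = inj₂ (*-cancelˡ x≢0 (trans xy≡0 (sym (zeroʳ x))))

  *-≢0 : ∀ {x y} → x ≢ 0# → y ≢ 0# → x * y ≢ 0#
  *-≢0 {x} {y} x≢0 y≢0 xy≡0 with x*y≡0⇒x≡0⊎y≡0 x y xy≡0
  ... | inj₁ x≡0 = x≢0 x≡0
  ... | inj₂ y≡0 = y≢0 y≡0

  ⁻¹-unique : ∀ {x y} → x * y ≡ 1# → y ≡ x ⁻¹
  ⁻¹-unique {x} {y} xy≡1 = *-cancelˡ x≢0 (trans xy≡1 (sym (inverseʳ x x≢0)))
    where
    x≢0 : x ≢ 0#
    x≢0 x≡0 = 0≢1 (trans (sym (zeroˡ y)) (trans (cong (_* y) (sym x≡0)) xy≡1))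

  ⁻¹-≢0 : ∀ {x} → x ≢ 0# → x ⁻¹ ≢ 0#
  ⁻¹-≢0 {x} x≢0 x⁻¹≡0 = 0≢1 (trans (sym (zeroʳ x)) (trans (cong (x *_) (sym x⁻¹≡0)) (inverseʳ x x≢0)))

  ⁻¹-involutive : ∀ {x} → x ≢ 0# → (x ⁻¹) ⁻¹ ≡ x
  ⁻¹-involutive x≢0 = sym (⁻¹-unique (x⁻¹*x≡1 x≢0))

  x*[x⁻¹*y]≡y : ∀ {x} y → x ≢ 0# → x * (x ⁻¹ * y) ≡ y
  x*[x⁻¹*y]≡y {x} y x≢0 = begin
    x * (x ⁻¹ * y)   ≡⟨ sym (*-assoc x (x ⁻¹) y) ⟩
    (x * x ⁻¹) * y   ≡⟨ cong (_* y) (inverseʳ x x≢0) ⟩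
    1# * y           ≡⟨ *-identityˡ y ⟩
    y                ∎

  ^≡^ᴿ : ∀ x n → x ^ n ≡ x Exp.^ n
  ^≡^ᴿ x zero    = refl
  ^≡^ᴿ x (suc n) = cong (x *_) (^≡^ᴿ x n)

  ^-distrib-* : ∀ x y n → (x * y) ^ n ≡ x ^ n * y ^ n
  ^-distrib-* x y n = trans (^≡^ᴿ (x * y) n)
    (trans (CExp.^-distrib-* x y n) (sym (cong₂ _*_ (^≡^ᴿ x n) (^≡^ᴿ y n))))

  ^-*-assoc : ∀ x m n → (x ^ m) ^ n ≡ x ^ (m ℕ.* n)
  ^-*-assoc x m n = trans (^≡^ᴿ (x ^ m) n) (trans (cong (Exp._^ n) (^≡^ᴿ x m))
    (trans (Exp.^-assocʳ x m n) (sym (^≡^ᴿ x (m ℕ.* n)))))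

  1^n≡1 : ∀ n → 1# ^ n ≡ 1#
  1^n≡1 zero    = refl
  1^n≡1 (suc n) = trans (*-identityˡ _) (1^n≡1 n)

  0^n≡0 : ∀ {n} → n > 0 → 0# ^ n ≡ 0#
  0^n≡0 {suc n} _ = zeroˡ (0# ^ n)

  ^-≢0 : ∀ {x} n → x ≢ 0# → x ^ n ≢ 0#
  ^-≢0 zero    _   = λ 1≡0 → 0≢1 (sym 1≡0)
  ^-≢0 (suc n) x≢0 = *-≢0 x≢0 (^-≢0 n x≢0)

  ⁻¹-^ : ∀ {x} n → x ≢ 0# → (x ⁻¹) ^ n ≡ (x ^ n) ⁻¹
  ⁻¹-^ {x} n x≢0 = ⁻¹-unique (begin
    x ^ n * (x ⁻¹) ^ n   ≡⟨ sym (^-distrib-* x (x ⁻¹) n) ⟩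
    (x * x ⁻¹) ^ n       ≡⟨ cong (_^ n) (inverseʳ x x≢0) ⟩
    1# ^ n               ≡⟨ 1^n≡1 n ⟩
    1#                   ∎)

  x⁻¹*y+x⁻¹≡1 : ∀ {x y} → x ≢ 0# → y + 1# ≡ x → x ⁻¹ * y + x ⁻¹ ≡ 1#
  x⁻¹*y+x⁻¹≡1 {x} {y} x≢0 y+1≡x = begin
    x ⁻¹ * y + x ⁻¹        ≡⟨ cong (x ⁻¹ * y +_) (sym (*-identityʳ (x ⁻¹))) ⟩
    x ⁻¹ * y + x ⁻¹ * 1#   ≡⟨ sym (distribˡ (x ⁻¹) y 1#) ⟩
    x ⁻¹ * (y + 1#)        ≡⟨ cong (x ⁻¹ *_) y+1≡x ⟩
    x ⁻¹ * x               ≡⟨ x⁻¹*x≡1 x≢0 ⟩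
    1#                     ∎

  [x⁻¹*y]^n+[x⁻¹]^n≡-1 : ∀ {x y} n → x ≢ 0# → x ^ n + y ^ n ≡ - 1# →
    (x ⁻¹ * y) ^ n + (x ⁻¹) ^ n ≡ - 1#
  [x⁻¹*y]^n+[x⁻¹]^n≡-1 {x} {y} n x≢0 sum≡-1 = begin
    (x ⁻¹ * y) ^ n + (x ⁻¹) ^ n           ≡⟨ cong₂ _+_ (^-distrib-* (x ⁻¹) y n) (sym (*-identityʳ _)) ⟩
    (x ⁻¹) ^ n * y ^ n + (x ⁻¹) ^ n * 1#   ≡⟨ sym (distribˡ ((x ⁻¹) ^ n) (y ^ n) 1#) ⟩
    (x ⁻¹) ^ n * (y ^ n + 1#)             ≡⟨ cong ((x ⁻¹) ^ n *_) (x+y≡-1⇒y+1≡-x (x ^ n) (y ^ n) sum≡-1) ⟩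
    (x ⁻¹) ^ n * - (x ^ n)                ≡⟨ sym (-‿distribʳ-* ((x ⁻¹) ^ n) (x ^ n)) ⟩
    - ((x ⁻¹) ^ n * x ^ n)                ≡⟨ cong -_ (sym (^-distrib-* (x ⁻¹) x n)) ⟩
    - ((x ⁻¹ * x) ^ n)                    ≡⟨ cong (λ t → - (t ^ n)) (x⁻¹*x≡1 x≢0) ⟩
    - (1# ^ n)                            ≡⟨ cong -_ (1^n≡1 n) ⟩
    - 1#                                  ∎

  -‿^ : ∀ x n → (- x) ^ n ≡ (- 1#) ^ n * x ^ n
  -‿^ x n = trans (cong (_^ n) (sym (-1*x≈-x x))) (^-distrib-* (- 1#) x n)

  [-1]^odd≡-1 : ∀ n → n % 2 ≡ 1 → (- 1#) ^ n ≡ - 1#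
  [-1]^odd≡-1 n odd = begin
    (- 1#) ^ n                                ≡⟨ cong ((- 1#) ^_) (odd⇒≡1+[n/2]*2 n odd) ⟩
    (- 1#) * (- 1#) ^ (n / 2 ℕ.* 2)            ≡⟨ cong (λ k → (- 1#) * (- 1#) ^ k) (ℕ.*-comm (n / 2) 2) ⟩
    (- 1#) * (- 1#) ^ (2 ℕ.* (n / 2))          ≡⟨ cong ((- 1#) *_) (sym (^-*-assoc (- 1#) 2 (n / 2))) ⟩
    (- 1#) * ((- 1#) * ((- 1#) * 1#)) ^ (n / 2) ≡⟨ cong (λ y → (- 1#) * y ^ (n / 2)) [-1]²≡1 ⟩
    (- 1#) * 1# ^ (n / 2)                     ≡⟨ cong ((- 1#) *_) (1^n≡1 (n / 2)) ⟩
    (- 1#) * 1#                               ≡⟨ *-identityʳ (- 1#) ⟩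
    - 1#                                      ∎
    where
    [-1]²≡1 : (- 1#) * ((- 1#) * 1#) ≡ 1#
    [-1]²≡1 = begin
      (- 1#) * ((- 1#) * 1#)   ≡⟨ cong ((- 1#) *_) (*-identityʳ (- 1#)) ⟩
      (- 1#) * (- 1#)          ≡⟨ -1*x≈-x (- 1#) ⟩
      - (- 1#)                 ≡⟨ -‿involutive 1# ⟩
      1#                       ∎

  fromℕ≡×1 : ∀ n → fromℕ n ≡ n ×ᴿ 1#
  fromℕ≡×1 zero    = refl
  fromℕ≡×1 (suc n) = cong (1# +_) (fromℕ≡×1 n)

  fromℕ-* : ∀ m n → fromℕ (m ℕ.* n) ≡ fromℕ m * fromℕ n
  fromℕ-* m n = trans (fromℕ≡×1 (m ℕ.* n))
    (trans (×1-homo-* m n) (sym (cong₂ _*_ (fromℕ≡×1 m) (fromℕ≡×1 n))))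

  fromℕ-2≡two : fromℕ 2 ≡ two
  fromℕ-2≡two = cong (1# +_) (+-identityʳ 1#)

  odd-char⇒two≢0 : ∀ p → HasChar p → p % 2 ≡ 1 → two ≢ 0#
  odd-char⇒two≢0 p char odd two≡0 = 0≢1 (begin
    0#                              ≡⟨ sym char ⟩
    fromℕ p                         ≡⟨ cong fromℕ (odd⇒≡1+[n/2]*2 p odd) ⟩
    1# + fromℕ (p / 2 ℕ.* 2)         ≡⟨ cong (1# +_) (fromℕ-* (p / 2) 2) ⟩
    1# + fromℕ (p / 2) * fromℕ 2     ≡⟨ cong (λ t → 1# + fromℕ (p / 2) * t) (trans fromℕ-2≡two two≡0) ⟩
    1# + fromℕ (p / 2) * 0#          ≡⟨ cong (1# +_) (zeroʳ _) ⟩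
    1# + 0#                         ≡⟨ +-identityʳ 1# ⟩
    1#                              ∎)

  two≢0⇒odd-char : ∀ {p} → Prime p → HasChar p → two ≢ 0# → p % 2 ≡ 1
  two≢0⇒odd-char {p} p-prime char two≢0 with n%2≡0⊎n%2≡1 p
  ... | inj₂ odd  = odd
  ... | inj₁ even with prime⇒irreducible p-prime (m%n≡0⇒n∣m p 2 even)
  ...   | inj₁ ()
  ...   | inj₂ 2≡p = ⊥-elim (two≢0 (trans (sym fromℕ-2≡two) (subst (λ n → fromℕ n ≡ 0#) (sym 2≡p) char)))

  char2⇒-1≡1 : two ≡ 0# → - 1# ≡ 1#
  char2⇒-1≡1 two≡0 = sym (inverseʳ-unique 1# 1# two≡0)

  units : List Carrier
  units = filter (λ x → ¬? (x ≟ 0#)) elements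

  ∈-units⁺ : ∀ {x} → x ≢ 0# → x ∈ units
  ∈-units⁺ {x} = ∈-filter⁺ (λ x → ¬? (x ≟ 0#)) (elements-complete x)

  ∈-units⁻ : ∀ {x} → x ∈ units → x ≢ 0#
  ∈-units⁻ x∈ = proj₂ (∈-filter⁻ (λ x → ¬? (x ≟ 0#)) {xs = elements} x∈)

  units-unique : Unique units
  units-unique = Unique.filter⁺ _ elements-unique

  order∸1≡length-units : order ∸ 1 ≡ length units
  order∸1≡length-units = cong (_∸ 1) (length-filter-≢ _≟_ elements-unique (elements-complete 0#))

  ∏ : List Carrier → Carrier
  ∏ = foldr _*_ 1#

  ∏-map-* : ∀ a xs → ∏ (map (a *_) xs) ≡ a ^ length xs * ∏ xs
  ∏-map-* a []       = sym (*-identityˡ 1#)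
  ∏-map-* a (x ∷ xs) = begin
    (a * x) * ∏ (map (a *_) xs)          ≡⟨ cong ((a * x) *_) (∏-map-* a xs) ⟩
    (a * x) * (a ^ length xs * ∏ xs)     ≡⟨ *-assoc a x _ ⟩
    a * (x * (a ^ length xs * ∏ xs))     ≡⟨ cong (a *_) (sym (*-assoc x _ _)) ⟩
    a * ((x * a ^ length xs) * ∏ xs)     ≡⟨ cong (λ t → a * (t * ∏ xs)) (*-comm x _) ⟩
    a * ((a ^ length xs * x) * ∏ xs)     ≡⟨ cong (a *_) (*-assoc _ x _) ⟩
    a * (a ^ length xs * (x * ∏ xs))     ≡⟨ sym (*-assoc a _ _) ⟩
    (a * a ^ length xs) * (x * ∏ xs)     ∎

  ∏-≢0 : ∀ xs → (∀ {x} → x ∈ xs → x ≢ 0#) → ∏ xs ≢ 0#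
  ∏-≢0 []       _   1≡0 = 0≢1 (sym 1≡0)
  ∏-≢0 (x ∷ xs) ≢0 = *-≢0 (≢0 (here refl)) (∏-≢0 xs (λ x∈ → ≢0 (there x∈)))

  -- Multiplication by a unit permutes the units.
  fermat : ∀ {a} → a ≢ 0# → a ^ (order ∸ 1) ≡ 1#
  fermat {a} a≢0 = begin
    a ^ (order ∸ 1)    ≡⟨ cong (a ^_) order∸1≡length-units ⟩
    a ^ length units   ≡⟨ *-cancelˡ (∏-≢0 units ∈-units⁻) (trans (*-comm (∏ units) _) ∏-invariant) ⟩
    1#                 ∎
    where
    ↭units : map (a *_) units ↭ units
    ↭units = unique-same-members⇒↭
      (Unique.map⁺ (*-cancelˡ a≢0) units-unique) units-unique
      ⊆units
      (λ {y} y∈ → subst (_∈ map (a *_) units) (x*[x⁻¹*y]≡y y a≢0)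
        (∈-map⁺ (a *_) (∈-units⁺ (*-≢0 (⁻¹-≢0 a≢0) (∈-units⁻ y∈)))))
      where
      ⊆units : ∀ {y} → y ∈ map (a *_) units → y ∈ units
      ⊆units y∈ with ∈-map⁻ (a *_) y∈
      ... | x , x∈ , refl = ∈-units⁺ (*-≢0 a≢0 (∈-units⁻ x∈))
    ∏-invariant : a ^ length units * ∏ units ≡ ∏ units * 1#
    ∏-invariant = begin
      a ^ length units * ∏ units   ≡⟨ sym (∏-map-* a units) ⟩
      ∏ (map (a *_) units)         ≡⟨ foldr-commMonoid (setoid Carrier) *-isCommutativeMonoid (↭⇒↭ₛ ↭units) ⟩
      ∏ units                      ≡⟨ sym (*-identityʳ _) ⟩
      ∏ units * 1#                 ∎

  ^[k*[q-1]]≡1 : ∀ {z} k → z ≢ 0# → z ^ (k ℕ.* (order ∸ 1)) ≡ 1#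
  ^[k*[q-1]]≡1 {z} k z≢0 = begin
    z ^ (k ℕ.* (order ∸ 1))   ≡⟨ cong (z ^_) (ℕ.*-comm k (order ∸ 1)) ⟩
    z ^ ((order ∸ 1) ℕ.* k)   ≡⟨ sym (^-*-assoc z (order ∸ 1) k) ⟩
    (z ^ (order ∸ 1)) ^ k     ≡⟨ cong (_^ k) (fermat z≢0) ⟩
    1# ^ k                    ≡⟨ 1^n≡1 k ⟩
    1#                        ∎

  ^[1+k*[q-1]]≡id : ∀ {z} k → z ≢ 0# → z ^ suc (k ℕ.* (order ∸ 1)) ≡ z
  ^[1+k*[q-1]]≡id {z} k z≢0 = trans (cong (z *_) (^[k*[q-1]]≡1 k z≢0)) (*-identityʳ z)

  2∣q-1 : two ≢ 0# → 2 ∣ order ∸ 1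
  2∣q-1 two≢0 = subst (2 ∣_) (sym order∸1≡length-units)
    (2∣length-involution _≟_ -_ -‿involutive units-unique
      (λ x∈ → ∈-units⁺ (λ -x≡0 → ∈-units⁻ x∈ (-x≡0⇒x≡0 -x≡0)))
      (λ x∈ -x≡x → ∈-units⁻ x∈ (-x≡x⇒x≡0 -x≡x)))
    where
    -x≡0⇒x≡0 : ∀ {x} → - x ≡ 0# → x ≡ 0#
    -x≡0⇒x≡0 {x} -x≡0 = trans (sym (-‿involutive x)) (trans (cong -_ -x≡0) ε⁻¹≈ε)
    -x≡x⇒x≡0 : ∀ {x} → - x ≡ x → x ≡ 0#
    -x≡x⇒x≡0 {x} -x≡x = fromInj₁ (λ two≡0 → ⊥-elim (two≢0 two≡0)) (x*y≡0⇒x≡0⊎y≡0 x two x*two≡0)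
      where
      x*two≡0 : x * two ≡ 0#
      x*two≡0 = trans (sym (x+x≡x*two x)) (trans (cong (x +_) (sym -x≡x)) (-‿inverseʳ x))

  mutual
    -- The list search local to rootOf, named through unification.
    rootOf-search : ℕ → Carrier → List Carrier → Carrier
    rootOf-search s y = _

    rootOf≡search : ∀ s y → rootOf s y ≡ rootOf-search s y elements
    rootOf≡search s y with elements
    ... | _ = refl

  search-^ : ∀ s y xs {r} → r ∈ xs → r ^ s ≡ y → rootOf-search s y xs ^ s ≡ y
  search-^ s y (x ∷ xs) r∈ r^s≡y with (x ^ s) ≟ y
  ... | yes x^s≡y = x^s≡y
  ... | no  x^s≢y with r∈
  ...   | here refl  = ⊥-elim (x^s≢y r^s≡y)
  ...   | there r∈xs = search-^ s y xs r∈xs r^s≡y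

  rootOf-^ : ∀ s {y} → (∃ λ r → r ^ s ≡ y) → rootOf s y ^ s ≡ y
  rootOf-^ s {y} (r , r^s≡y) =
    trans (cong (_^ s) (rootOf≡search s y)) (search-^ s y elements (elements-complete r) r^s≡y)

  module PowerMap (s : ℕ) (s>0 : s > 0) (s⊥q-1 : Coprime s (order ∸ 1)) where

    -- Bézout gives x with x s ≡ ±1 modulo q - 1, so the inverse of z ↦ z ^ s is t ↦ t ^ (± x).
    root : Carrier → Carrier
    root t with coprime-Bézout s⊥q-1
    ... | Bézout.+- x _ _ = t ^ x
    ... | Bézout.-+ x _ _ = (t ^ x) ⁻¹

    root-^s : ∀ {z} → z ≢ 0# → root (z ^ s) ≡ z
    root-^s {z} z≢0 with coprime-Bézout s⊥q-1
    ... | Bézout.+- x k 1+k[q-1]≡xs = begin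
      (z ^ s) ^ x                  ≡⟨ ^-*-assoc z s x ⟩
      z ^ (s ℕ.* x)                ≡⟨ cong (z ^_) (trans (ℕ.*-comm s x) (sym 1+k[q-1]≡xs)) ⟩
      z ^ suc (k ℕ.* (order ∸ 1))  ≡⟨ ^[1+k*[q-1]]≡id k z≢0 ⟩
      z                            ∎
    ... | Bézout.-+ x k 1+xs≡k[q-1] = sym (⁻¹-unique (begin
      (z ^ s) ^ x * z              ≡⟨ *-comm _ z ⟩
      z * (z ^ s) ^ x              ≡⟨ cong (z *_) (^-*-assoc z s x) ⟩
      z ^ suc (s ℕ.* x)            ≡⟨ cong (λ n → z ^ suc n) (ℕ.*-comm s x) ⟩
      z ^ suc (x ℕ.* s)            ≡⟨ cong (z ^_) 1+xs≡k[q-1] ⟩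
      z ^ (k ℕ.* (order ∸ 1))      ≡⟨ ^[k*[q-1]]≡1 k z≢0 ⟩
      1#                           ∎))

    ^s-root : ∀ {t} → t ≢ 0# → root t ^ s ≡ t
    ^s-root {t} t≢0 with coprime-Bézout s⊥q-1
    ... | Bézout.+- x k 1+k[q-1]≡xs = begin
      (t ^ x) ^ s                  ≡⟨ ^-*-assoc t x s ⟩
      t ^ (x ℕ.* s)                ≡⟨ cong (t ^_) (sym 1+k[q-1]≡xs) ⟩
      t ^ suc (k ℕ.* (order ∸ 1))  ≡⟨ ^[1+k*[q-1]]≡id k t≢0 ⟩
      t                            ∎
    ... | Bézout.-+ x k 1+xs≡k[q-1] = begin
      ((t ^ x) ⁻¹) ^ s             ≡⟨ ⁻¹-^ s (^-≢0 x t≢0) ⟩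
      ((t ^ x) ^ s) ⁻¹             ≡⟨ cong _⁻¹ (^-*-assoc t x s) ⟩
      (t ^ (x ℕ.* s)) ⁻¹           ≡⟨ cong _⁻¹ (⁻¹-unique t*t^[xs]≡1) ⟩
      (t ⁻¹) ⁻¹                    ≡⟨ ⁻¹-involutive t≢0 ⟩
      t                            ∎
      where
      t*t^[xs]≡1 : t * t ^ (x ℕ.* s) ≡ 1#
      t*t^[xs]≡1 = trans (cong (t ^_) 1+xs≡k[q-1]) (^[k*[q-1]]≡1 k t≢0)

    ^s≡0⇒≡0 : ∀ {z} → z ^ s ≡ 0# → z ≡ 0#
    ^s≡0⇒≡0 {z} z^s≡0 with z ≟ 0#
    ... | yes z≡0 = z≡0
    ... | no  z≢0 = ⊥-elim (^-≢0 s z≢0 z^s≡0)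

    ^s-injective : ∀ {z u} → z ^ s ≡ u ^ s → z ≡ u
    ^s-injective {z} {u} z^s≡u^s with z ≟ 0# | u ≟ 0#
    ... | yes z≡0 | yes u≡0 = trans z≡0 (sym u≡0)
    ... | yes z≡0 | no  u≢0 = ⊥-elim (u≢0 (^s≡0⇒≡0 (trans (sym z^s≡u^s) (trans (cong (_^ s) z≡0) (0^n≡0 s>0)))))
    ... | no  z≢0 | yes u≡0 = ⊥-elim (z≢0 (^s≡0⇒≡0 (trans z^s≡u^s (trans (cong (_^ s) u≡0) (0^n≡0 s>0)))))
    ... | no  z≢0 | no  u≢0 = trans (sym (root-^s z≢0)) (trans (cong root z^s≡u^s) (root-^s u≢0))

    ^s-surjective : ∀ t → ∃ λ r → r ^ s ≡ t
    ^s-surjective t with t ≟ 0#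
    ... | yes t≡0 = 0# , trans (0^n≡0 s>0) (sym t≡0)
    ... | no  t≢0 = root t , ^s-root t≢0

    rootOf-^s : ∀ t → rootOf s t ^ s ≡ t
    rootOf-^s t = rootOf-^ s (^s-surjective t)

    s-odd : two ≢ 0# → s % 2 ≡ 1
    s-odd two≢0 with n%2≡0⊎n%2≡1 s
    ... | inj₂ odd  = odd
    ... | inj₁ even with s⊥q-1 (m%n≡0⇒n∣m s 2 even , 2∣q-1 two≢0)
    ...   | ()

    [-1]^s≡-1 : (- 1#) ^ s ≡ - 1#
    [-1]^s≡-1 with two ≟ 0#
    ... | no  two≢0 = [-1]^odd≡-1 s (s-odd two≢0)
    ... | yes two≡0 = begin
      (- 1#) ^ s   ≡⟨ cong (_^ s) (char2⇒-1≡1 two≡0) ⟩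
      1# ^ s       ≡⟨ 1^n≡1 s ⟩
      1#           ≡⟨ sym (char2⇒-1≡1 two≡0) ⟩
      - 1#         ∎

    -‿^s : ∀ x → (- x) ^ s ≡ - (x ^ s)
    -‿^s x = begin
      (- x) ^ s              ≡⟨ -‿^ x s ⟩
      (- 1#) ^ s * x ^ s     ≡⟨ cong (_* x ^ s) [-1]^s≡-1 ⟩
      (- 1#) * x ^ s         ≡⟨ -1*x≈-x (x ^ s) ⟩
      - (x ^ s)              ∎

  Pair : Set
  Pair = Carrier × Carrier

  module Equation (s : ℕ) (t₁ t₂ a b : Carrier) where

    IsSolution : Pair → Set
    IsSolution (v₁ , v₂) = (t₁ * v₁ + t₂ * v₂ ≡ a) × (v₁ ^ s + v₂ ^ s ≡ b ^ s)

    solution? : Decidable IsSolution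
    solution? (v₁ , v₂) = ((t₁ * v₁ + t₂ * v₂) ≟ a) ×-dec ((v₁ ^ s + v₂ ^ s) ≟ (b ^ s))

    solutions : List Pair
    solutions = filter solution? (cartesianProduct elements elements)

    ∈-solutions⁺ : ∀ {v} → IsSolution v → v ∈ solutions
    ∈-solutions⁺ {v₁ , v₂} =
      ∈-filter⁺ solution? (∈-cartesianProduct⁺ (elements-complete v₁) (elements-complete v₂))

    ∈-solutions⁻ : ∀ {v} → v ∈ solutions → IsSolution v
    ∈-solutions⁻ v∈ = proj₂ (∈-filter⁻ solution? {xs = cartesianProduct elements elements} v∈)

    solutions-unique : Unique solutions
    solutions-unique = Unique.filter⁺ solution? (Unique.cartesianProduct⁺ elements-unique elements-unique)

  module Counts (s : ℕ) (s>0 : s > 0) (s⊥q-1 : Coprime s (order ∸ 1)) where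

    open PowerMap s s>0 s⊥q-1

    Q⁻ Q⁺ : Carrier → ℕ
    Q⁻ = Q s 1# (- 1#) 1#
    Q⁺ = Q s 1# 1# 1#

    module D = Equation s 1# (- 1#) 1#
    module S = Equation s 1# 1# 1#

    negSwap : Pair → Pair
    negSwap (v₁ , v₂) = (- v₂ , - v₁)

    negSwap-involutive : ∀ v → negSwap (negSwap v) ≡ v
    negSwap-involutive (v₁ , v₂) = cong₂ _,_ (-‿involutive v₁) (-‿involutive v₂)

    negSwap-solution : ∀ w {v} → D.IsSolution w v → D.IsSolution (- w) (negSwap v)
    negSwap-solution w {v₁ , v₂} (linear , power) = linear′ , power′
      where
      linear′ : 1# * (- v₂) + (- 1#) * (- v₁) ≡ 1#
      linear′ = begin
        1# * (- v₂) + (- 1#) * (- v₁)   ≡⟨ 1*x+-1*y≡x-y (- v₂) (- v₁) ⟩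
        (- v₂) + - (- v₁)              ≡⟨ cong ((- v₂) +_) (-‿involutive v₁) ⟩
        (- v₂) + v₁                    ≡⟨ +-comm (- v₂) v₁ ⟩
        v₁ - v₂                        ≡⟨ sym (1*x+-1*y≡x-y v₁ v₂) ⟩
        1# * v₁ + (- 1#) * v₂          ≡⟨ linear ⟩
        1#                             ∎
      power′ : (- v₂) ^ s + (- v₁) ^ s ≡ (- w) ^ s
      power′ = begin
        (- v₂) ^ s + (- v₁) ^ s        ≡⟨ cong₂ _+_ (-‿^s v₂) (-‿^s v₁) ⟩
        - (v₂ ^ s) + - (v₁ ^ s)        ≡⟨ ⁻¹-∙-comm (v₂ ^ s) (v₁ ^ s) ⟩
        - (v₂ ^ s + v₁ ^ s)            ≡⟨ cong -_ (+-comm (v₂ ^ s) (v₁ ^ s)) ⟩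
        - (v₁ ^ s + v₂ ^ s)            ≡⟨ cong -_ power ⟩
        - (w ^ s)                      ≡⟨ sym (-‿^s w) ⟩
        (- w) ^ s                      ∎

    Q⁻-neg : ∀ w → Q⁻ w ≡ Q⁻ (- w)
    Q⁻-neg w = length-≡-inverses negSwap negSwap
      (D.solutions-unique w) (D.solutions-unique (- w))
      (λ v∈ → D.∈-solutions⁺ (- w) (negSwap-solution w (D.∈-solutions⁻ w v∈)))
      (λ {v} v∈ → D.∈-solutions⁺ w (subst (λ b → D.IsSolution b (negSwap v)) (-‿involutive w)
        (negSwap-solution (- w) (D.∈-solutions⁻ (- w) v∈))))
      (λ {v} _ → negSwap-involutive v) (λ {v} _ → negSwap-involutive v)

    module D⁻ = D (- 1#)
    module S⁻ = S (- 1#)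

    first≡0? : Decidable (λ (v : Pair) → proj₁ v ≡ 0#)
    first≡0? v = proj₁ v ≟ 0#

    length-first≡0≡1 : length (filter first≡0? D⁻.solutions) ≡ 1
    length-first≡0≡1 = length≡1 (Unique.filter⁺ first≡0? D⁻.solutions-unique)
      (∈-filter⁺ first≡0? (D⁻.∈-solutions⁺ (linear , power)) refl) only
      where
      linear : 1# * 0# + (- 1#) * (- 1#) ≡ 1#
      linear = begin
        1# * 0# + (- 1#) * (- 1#)   ≡⟨ 1*x+-1*y≡x-y 0# (- 1#) ⟩
        0# + - (- 1#)              ≡⟨ +-identityˡ _ ⟩
        - (- 1#)                   ≡⟨ -‿involutive 1# ⟩
        1#                         ∎
      power : 0# ^ s + (- 1#) ^ s ≡ (- 1#) ^ s
      power = trans (cong (_+ (- 1#) ^ s) (0^n≡0 s>0)) (+-identityˡ _)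
      only : ∀ {v} → v ∈ filter first≡0? D⁻.solutions → v ≡ (0# , - 1#)
      only {v₁ , v₂} v∈ with ∈-filter⁻ first≡0? {xs = D⁻.solutions} v∈
      ... | v∈D , v₁≡0 with D⁻.∈-solutions⁻ v∈D
      ...   | linear′ , _ = cong₂ _,_ v₁≡0 (trans (sym (-‿involutive v₂)) (cong -_ -v₂≡1))
        where
        -v₂≡1 : - v₂ ≡ 1#
        -v₂≡1 = begin
          - v₂                     ≡⟨ sym (+-identityˡ (- v₂)) ⟩
          0# + - v₂                ≡⟨ cong (_- v₂) (sym v₁≡0) ⟩
          v₁ - v₂                  ≡⟨ sym (1*x+-1*y≡x-y v₁ v₂) ⟩
          1# * v₁ + (- 1#) * v₂    ≡⟨ linear′ ⟩
          1#                       ∎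

    second≢0 : two ≢ 0# → ∀ {u} → S⁻.IsSolution u → proj₂ u ≢ 0#
    second≢0 two≢0 {u₁ , u₂} (linear , power) u₂≡0 = two≢0 (begin
      1# + 1#              ≡⟨ cong (1# +_) 1≡-1 ⟩
      1# + - 1#            ≡⟨ -‿inverseʳ 1# ⟩
      0#                   ∎)
      where
      u₁≡1 : u₁ ≡ 1#
      u₁≡1 = begin
        u₁                 ≡⟨ sym (+-identityʳ u₁) ⟩
        u₁ + 0#            ≡⟨ cong (u₁ +_) (sym u₂≡0) ⟩
        u₁ + u₂            ≡⟨ sym (1*x+1*y≡x+y u₁ u₂) ⟩
        1# * u₁ + 1# * u₂  ≡⟨ linear ⟩
        1#                 ∎
      1≡-1 : 1# ≡ - 1#
      1≡-1 = begin
        1#                 ≡⟨ sym (1^n≡1 s) ⟩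
        1# ^ s             ≡⟨ cong (_^ s) (sym u₁≡1) ⟩
        u₁ ^ s             ≡⟨ sym (+-identityʳ _) ⟩
        u₁ ^ s + 0#        ≡⟨ cong (u₁ ^ s +_) (sym (trans (cong (_^ s) u₂≡0) (0^n≡0 s>0))) ⟩
        u₁ ^ s + u₂ ^ s    ≡⟨ trans power [-1]^s≡-1 ⟩
        - 1#               ∎

    toSum toDifference : Pair → Pair
    toSum        (v₁ , v₂) = (v₁ ⁻¹ * v₂ , v₁ ⁻¹)
    toDifference (u₁ , u₂) = (u₂ ⁻¹ , u₂ ⁻¹ * u₁)

    toDifference-toSum : ∀ {v} → proj₁ v ≢ 0# → toDifference (toSum v) ≡ v
    toDifference-toSum {v₁ , v₂} v₁≢0 = cong₂ _,_ (⁻¹-involutive v₁≢0)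
      (trans (cong (_* (v₁ ⁻¹ * v₂)) (⁻¹-involutive v₁≢0)) (x*[x⁻¹*y]≡y v₂ v₁≢0))

    toSum-toDifference : ∀ {u} → proj₂ u ≢ 0# → toSum (toDifference u) ≡ u
    toSum-toDifference {u₁ , u₂} u₂≢0 = cong₂ _,_
      (trans (cong (_* (u₂ ⁻¹ * u₁)) (⁻¹-involutive u₂≢0)) (x*[x⁻¹*y]≡y u₁ u₂≢0))
      (⁻¹-involutive u₂≢0)

    toSum-solution : ∀ {v} → proj₁ v ≢ 0# → D⁻.IsSolution v → S⁻.IsSolution (toSum v)
    toSum-solution {v₁ , v₂} v₁≢0 (linear , power) =
        trans (1*x+1*y≡x+y _ _) (x⁻¹*y+x⁻¹≡1 v₁≢0 v₂+1≡v₁)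
      , trans ([x⁻¹*y]^n+[x⁻¹]^n≡-1 s v₁≢0 (trans power [-1]^s≡-1)) (sym [-1]^s≡-1)
      where
      v₂+1≡v₁ : v₂ + 1# ≡ v₁
      v₂+1≡v₁ = begin
        v₂ + 1#            ≡⟨ cong (v₂ +_) (trans (sym linear) (1*x+-1*y≡x-y v₁ v₂)) ⟩
        v₂ + (v₁ - v₂)     ≡⟨ sym (+-assoc v₂ v₁ (- v₂)) ⟩
        v₂ + v₁ - v₂       ≡⟨ xyx⁻¹≈y v₂ v₁ ⟩
        v₁                 ∎

    toDifference-solution : ∀ {u} → proj₂ u ≢ 0# → S⁻.IsSolution u → D⁻.IsSolution (toDifference u)
    toDifference-solution {u₁ , u₂} u₂≢0 (linear , power) = linear′ , power′
      where
      -u₁+1≡u₂ : - u₁ + 1# ≡ u₂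
      -u₁+1≡u₂ = begin
        - u₁ + 1#          ≡⟨ cong (- u₁ +_) (trans (sym linear) (1*x+1*y≡x+y u₁ u₂)) ⟩
        - u₁ + (u₁ + u₂)   ≡⟨ sym (+-assoc (- u₁) u₁ u₂) ⟩
        - u₁ + u₁ + u₂     ≡⟨ cong (_+ u₂) (-‿inverseˡ u₁) ⟩
        0# + u₂            ≡⟨ +-identityˡ u₂ ⟩
        u₂                 ∎
      linear′ : 1# * u₂ ⁻¹ + (- 1#) * (u₂ ⁻¹ * u₁) ≡ 1#
      linear′ = begin
        1# * u₂ ⁻¹ + (- 1#) * (u₂ ⁻¹ * u₁)   ≡⟨ 1*x+-1*y≡x-y _ _ ⟩
        u₂ ⁻¹ - u₂ ⁻¹ * u₁                   ≡⟨ +-comm (u₂ ⁻¹) _ ⟩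
        - (u₂ ⁻¹ * u₁) + u₂ ⁻¹                ≡⟨ cong (_+ u₂ ⁻¹) (-‿distribʳ-* (u₂ ⁻¹) u₁) ⟩
        u₂ ⁻¹ * - u₁ + u₂ ⁻¹                  ≡⟨ x⁻¹*y+x⁻¹≡1 u₂≢0 -u₁+1≡u₂ ⟩
        1#                                   ∎
      power′ : (u₂ ⁻¹) ^ s + (u₂ ⁻¹ * u₁) ^ s ≡ (- 1#) ^ s
      power′ = begin
        (u₂ ⁻¹) ^ s + (u₂ ⁻¹ * u₁) ^ s   ≡⟨ +-comm _ _ ⟩
        (u₂ ⁻¹ * u₁) ^ s + (u₂ ⁻¹) ^ s   ≡⟨ [x⁻¹*y]^n+[x⁻¹]^n≡-1 s u₂≢0 (trans (+-comm _ _) (trans power [-1]^s≡-1)) ⟩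
        - 1#                             ≡⟨ sym [-1]^s≡-1 ⟩
        (- 1#) ^ s                       ∎

    length-first≢0≡Q⁺[-1] : two ≢ 0# → length (filter (∁? first≡0?) D⁻.solutions) ≡ Q⁺ (- 1#)
    length-first≢0≡Q⁺[-1] two≢0 = length-≡-inverses toSum toDifference
      (Unique.filter⁺ (∁? first≡0?) D⁻.solutions-unique) S⁻.solutions-unique
      (λ v∈ → let v∈D , v₁≢0 = ∈-first≢0⁻ v∈ in S⁻.∈-solutions⁺ (toSum-solution v₁≢0 (D⁻.∈-solutions⁻ v∈D)))
      (λ u∈ → let u = S⁻.∈-solutions⁻ u∈; u₂≢0 = second≢0 two≢0 u in
        ∈-filter⁺ (∁? first≡0?) (D⁻.∈-solutions⁺ (toDifference-solution u₂≢0 u)) (⁻¹-≢0 u₂≢0))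
      (λ v∈ → toDifference-toSum (proj₂ (∈-first≢0⁻ v∈)))
      (λ u∈ → toSum-toDifference (second≢0 two≢0 (S⁻.∈-solutions⁻ u∈)))
      where
      ∈-first≢0⁻ : ∀ {v} → v ∈ filter (∁? first≡0?) D⁻.solutions → v ∈ D⁻.solutions × proj₁ v ≢ 0#
      ∈-first≢0⁻ = ∈-filter⁻ (∁? first≡0?) {xs = D⁻.solutions}

    Q⁻[-1]≡1+Q⁺[-1] : two ≢ 0# → Q⁻ (- 1#) ≡ suc (Q⁺ (- 1#))
    Q⁻[-1]≡1+Q⁺[-1] two≢0 = trans (length-filter-∁ first≡0? D⁻.solutions)
      (cong₂ ℕ._+_ length-first≡0≡1 (length-first≢0≡Q⁺[-1] two≢0))

    diagonal? : Decidable (λ (v : Pair) → proj₁ v ≡ proj₂ v)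
    diagonal? v = proj₁ v ≟ proj₂ v

    diagonal : Carrier → List Pair
    diagonal w = filter diagonal? (S.solutions w)

    Q⁺%2≡diagonal%2 : ∀ w → Q⁺ w % 2 ≡ length (diagonal w) % 2
    Q⁺%2≡diagonal%2 w = begin
      length (S.solutions w) % 2                           ≡⟨ cong (_% 2) (length-filter-∁ diagonal? (S.solutions w)) ⟩
      (length (diagonal w) ℕ.+ length offDiagonal) % 2     ≡⟨ %-remove-+ʳ (length (diagonal w)) 2∣offDiagonal ⟩
      length (diagonal w) % 2                              ∎
      where
      offDiagonal : List Pair
      offDiagonal = filter (∁? diagonal?) (S.solutions w)
      2∣offDiagonal : 2 ∣ length offDiagonal
      2∣offDiagonal = 2∣length-involution (≡-dec _≟_ _≟_) swap (λ _ → refl)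
        (Unique.filter⁺ (∁? diagonal?) (S.solutions-unique w)) swap∈ swap≢
        where
        swap∈ : ∀ {v} → v ∈ offDiagonal → swap v ∈ offDiagonal
        swap∈ {v₁ , v₂} v∈ with ∈-filter⁻ (∁? diagonal?) {xs = S.solutions w} v∈
        ... | v∈S , v₁≢v₂ with S.∈-solutions⁻ w v∈S
        ...   | linear , power = ∈-filter⁺ (∁? diagonal?)
          (S.∈-solutions⁺ w (trans (+-comm _ _) linear , trans (+-comm _ _) power)) (λ v₂≡v₁ → v₁≢v₂ (sym v₂≡v₁))
        swap≢ : ∀ {v} → v ∈ offDiagonal → swap v ≢ v
        swap≢ {v₁ , v₂} v∈ swap-v≡v = proj₂ (∈-filter⁻ (∁? diagonal?) {xs = S.solutions w} v∈) (cong proj₂ swap-v≡v)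

    half : Carrier
    half = two ⁻¹

    half^s+half^s≡[rootOf2*half]^s : two ≢ 0# → half ^ s + half ^ s ≡ (rootOf s two * half) ^ s
    half^s+half^s≡[rootOf2*half]^s two≢0 = begin
      half ^ s + half ^ s              ≡⟨ x+x≡x*two (half ^ s) ⟩
      half ^ s * two                   ≡⟨ *-comm (half ^ s) two ⟩
      two * half ^ s                   ≡⟨ cong (_* half ^ s) (sym (rootOf-^s two)) ⟩
      rootOf s two ^ s * half ^ s      ≡⟨ sym (^-distrib-* (rootOf s two) half s) ⟩
      (rootOf s two * half) ^ s        ∎

    ∈-diagonal⁻ : ∀ {w v} → v ∈ diagonal w →
      two ≢ 0# × v ≡ (half , half) × (rootOf s two * half) ^ s ≡ w ^ s
    ∈-diagonal⁻ {w} {v₁ , v₂} v∈ with ∈-filter⁻ diagonal? {xs = S.solutions w} v∈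
    ... | v∈S , v₁≡v₂ with S.∈-solutions⁻ w v∈S
    ...   | linear , power = two≢0 , cong₂ _,_ v₁≡half (trans (sym v₁≡v₂) v₁≡half) , (begin
      (rootOf s two * half) ^ s   ≡⟨ sym (half^s+half^s≡[rootOf2*half]^s two≢0) ⟩
      half ^ s + half ^ s         ≡⟨ cong (λ x → x ^ s + x ^ s) (sym v₁≡half) ⟩
      v₁ ^ s + v₁ ^ s             ≡⟨ cong (λ x → v₁ ^ s + x ^ s) v₁≡v₂ ⟩
      v₁ ^ s + v₂ ^ s             ≡⟨ power ⟩
      w ^ s                       ∎)
      where
      v₁*two≡1 : v₁ * two ≡ 1#
      v₁*two≡1 = begin
        v₁ * two            ≡⟨ sym (x+x≡x*two v₁) ⟩
        v₁ + v₁             ≡⟨ cong (v₁ +_) v₁≡v₂ ⟩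
        v₁ + v₂             ≡⟨ sym (1*x+1*y≡x+y v₁ v₂) ⟩
        1# * v₁ + 1# * v₂   ≡⟨ linear ⟩
        1#                  ∎
      two≢0 : two ≢ 0#
      two≢0 two≡0 = 0≢1 (trans (sym (zeroʳ v₁)) (trans (cong (v₁ *_) (sym two≡0)) v₁*two≡1))
      v₁≡half : v₁ ≡ half
      v₁≡half = ⁻¹-unique (trans (*-comm two v₁) v₁*two≡1)

    length-diagonal≡1 : ∀ {w} → two ≢ 0# → w ≡ rootOf s two * half → length (diagonal w) ≡ 1
    length-diagonal≡1 {w} two≢0 w≡ = length≡1 (Unique.filter⁺ diagonal? (S.solutions-unique w))
      (∈-filter⁺ diagonal? (S.∈-solutions⁺ w (linear , power)) refl)
      (λ v∈ → proj₁ (proj₂ (∈-diagonal⁻ v∈)))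
      where
      linear : 1# * half + 1# * half ≡ 1#
      linear = begin
        1# * half + 1# * half   ≡⟨ 1*x+1*y≡x+y half half ⟩
        half + half             ≡⟨ x+x≡x*two half ⟩
        half * two              ≡⟨ x⁻¹*x≡1 two≢0 ⟩
        1#                      ∎
      power : half ^ s + half ^ s ≡ w ^ s
      power = trans (half^s+half^s≡[rootOf2*half]^s two≢0) (cong (_^ s) (sym w≡))

    length-diagonal≡0 : ∀ {w} → ¬ (two ≢ 0# × w ≡ rootOf s two * half) → length (diagonal w) ≡ 0
    length-diagonal≡0 ¬centre = length≡0 λ v∈ → case ∈-diagonal⁻ v∈ of λ
      { (two≢0 , _ , power) → ¬centre (two≢0 , sym (^s-injective power)) }

lemma4p8 : (K : FiniteField) → let open FiniteField K in
    (p : ℕ) → Prime p → HasChar p →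
    (s : ℕ) → s > 0 → gcd s (order ∸ 1) ≡ 1 →
    (w : Carrier) →
    (Q s 1# (- 1#) 1# w ≡ Q s 1# (- 1#) 1# (- w))
    × (p % 2 ≡ 1 →
         (Q s 1# (- 1#) 1# 1# ∸ 1 ≡ Q s 1# (- 1#) 1# (- 1#) ∸ 1)
         × (Q s 1# (- 1#) 1# (- 1#) ∸ 1 ≡ Q s 1# 1# 1# (- 1#)))
    × ((p % 2 ≡ 1 × w ≡ rootOf s (1# + 1#) * ((1# + 1#) ⁻¹)) → Q s 1# 1# 1# w % 2 ≡ 1)
    × (¬ (p % 2 ≡ 1 × w ≡ rootOf s (1# + 1#) * ((1# + 1#) ⁻¹)) → Q s 1# 1# 1# w % 2 ≡ 0)
lemma4p8 K p p-prime char s s>0 gcd≡1 w =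
    Q⁻-neg w
  , (λ p-odd → cong (_∸ 1) (Q⁻-neg 1#) , cong (_∸ 1) (Q⁻[-1]≡1+Q⁺[-1] (odd-char⇒two≢0 p char p-odd)))
  , (λ { (p-odd , w≡) → trans (Q⁺%2≡diagonal%2 w)
           (cong (_% 2) (length-diagonal≡1 (odd-char⇒two≢0 p char p-odd) w≡)) })
  , (λ ¬centre → trans (Q⁺%2≡diagonal%2 w)
           (cong (_% 2) (length-diagonal≡0 λ { (two≢0 , w≡) → ¬centre (two≢0⇒odd-char p-prime char two≢0 , w≡) })))
  where
  open FiniteField K
  open FiniteFieldProperties K
  open Counts s s>0 (gcd≡1⇒coprime gcd≡1)
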